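{- Let $G=(V,E)$ be a finite simple undirected graph and $\alpha>0$. (a) If there exists a set $W\subseteq V$ with $t_3(W)>\alpha|W|$, then every minimum $s$-$z$ cut $(S,T)$ in $H_\alpha$ satisfies $S\setminus\{s\}\neq\emptyset$. (b) If there is no set $W\subseteq V$ with $t_3(W)>\alpha|W|$, then the cut $(\{s\},A\cup B\cup\{z\})$ is a minimum $s$-$z$ cut in $H_\alpha$.
   Context: For $X\subseteq V$, $t_3(X)$ is the number of triangles of $G$ with all three vertices in $X$. For $v\in V$, $t_v$ is the number of triangles of $G$ containing $v$. The network $H_\alpha$ is the capacitated directed graph with vertex set $\{s\}\cup A\cup B\cup\{z\}$, where $A=V$ and $B$ contains one node for each triangle of $G$ ($s$ is the source, $z$ the sink), and arcs: for each $v\in A$ and each triangle containing $v$, an arc from $v$ to that triangle's node of capacity $1$; for each triangle $\{u,v,w\}$, arcs from its node to each of $u,v,w$ of capacity $2$; for each $v\in A$, an arc $(s,v)$ of capacity $t_v$ and an arc $(v,z)$ of capacity $3\alpha$. An $s$-$z$ cut $(S,T)$ is a partition of the vertex set with $s\in S$, $z\in T$; its capacity is the total capacity of arcs from $S$ to $T$.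
   Formalization: The parameter α ranges over the positive rationals. -}

module Defs where

open import Data.Nat using (ℕ; zero; suc)
import Data.Nat as N
open import Data.Bool using (Bool; true; false; _∧_; _∨_; not; if_then_else_)
open import Data.Fin using (Fin; zero; suc; _≟_; toℕ)
open import Data.Integer using (+_)
open import Data.Rational using (ℚ; _+_; _*_; _/_)
import Data.Rational
open import Relation.Nullary.Decidable using (⌊_⌋)
open import Relation.Binary.PropositionalEquality using (_≡_)
open import Data.Product using (_×_; _,_; ∃; ∃-syntax)
open import Data.Sum using (_⊎_)

record SimpleGraph (n : ℕ) : Set where
  field
    adj   : Fin n → Fin n → Bool
    sym   : ∀ u v → adj u v ≡ adj v u
    irrefl : ∀ v → adj v v ≡ false
open SimpleGraph public

Σℕ : (n : ℕ) → (Fin n → ℕ) → ℕ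
Σℕ zero f = 0
Σℕ (suc n) f = f zero N.+ Σℕ n (λ i → f (suc i))

bit : Bool → ℕ
bit true = 1
bit false = 0

Σ³ : (n : ℕ) → (Fin n → Fin n → Fin n → ℕ) → ℕ
Σ³ n f = Σℕ n λ i → Σℕ n λ j → Σℕ n λ k → f i j k

-- A triangle of G is represented uniquely by its vertices listed increasingly i < j < k.
isTri : ∀ {n} → SimpleGraph n → Fin n → Fin n → Fin n → Bool
isTri G i j k = (toℕ i N.<ᵇ toℕ j) ∧ (toℕ j N.<ᵇ toℕ k) ∧ adj G i j ∧ adj G j k ∧ adj G i k

Subset : ℕ → Set
Subset n = Fin n → Bool

card : ∀ {n} → Subset n → ℕ
card {n} X = Σℕ n (λ v → bit (X v))

t₃ : ∀ {n} → SimpleGraph n → Subset n → ℕ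
t₃ {n} G X = Σ³ n λ i j k → bit (isTri G i j k ∧ X i ∧ X j ∧ X k)

tv : ∀ {n} → SimpleGraph n → Fin n → ℕ
tv {n} G v = Σ³ n λ i j k → bit (isTri G i j k ∧ (⌊ v ≟ i ⌋ ∨ ⌊ v ≟ j ⌋ ∨ ⌊ v ≟ k ⌋))

ℕ→ℚ : ℕ → ℚ
ℕ→ℚ m = + m / 1

-- An s-z cut (S,T) of H_α: S = {s} ∪ {v ∈ A | inA v} ∪ {triangle node (i,j,k) | inB i j k}.
-- Triangle nodes are indexed by increasing triples (i<j<k) that are triangles of G;
-- the values of inB on triples that are not triangles are irrelevant (not nodes of H_α).
record Cut (n : ℕ) : Set where
  constructor cut
  field
    inA : Fin n → Bool
    inB : Fin n → Fin n → Fin n → Bool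
open Cut public

-- contribution of the arcs between triangle node t=(i,j,k) (in S iff b) and one of its vertices u:
-- arc u→t (capacity 1) crosses iff u ∈ S, t ∈ T;  arc t→u (capacity 2) crosses iff t ∈ S, u ∈ T.
triArc : Bool → Bool → ℕ
triArc uS b = bit (uS ∧ not b) N.+ 2 N.* bit (b ∧ not uS)

-- capacity of arcs s→v (capacity t_v) with v ∈ T and of all arcs between A and B
capℕ : ∀ {n} → SimpleGraph n → Cut n → ℕ
capℕ {n} G c =
  Σℕ n (λ v → if inA c v then 0 else tv G v)
  N.+ Σ³ n (λ i j k → if isTri G i j k
                        then triArc (inA c i) (inB c i j k)
                             N.+ triArc (inA c j) (inB c i j k)
                             N.+ triArc (inA c k) (inB c i j k)
                        else 0)

-- total capacity: plus arcs v→z (capacity 3α) with v ∈ S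
capacity : ∀ {n} → SimpleGraph n → ℚ → Cut n → ℚ
capacity G α c = ℕ→ℚ (capℕ G c) + ℕ→ℚ 3 * α * ℕ→ℚ (card (inA c))

IsMinCut : ∀ {n} → SimpleGraph n → ℚ → Cut n → Set
IsMinCut {n} G α c = (c' : Cut n) → capacity G α c Data.Rational.≤ capacity G α c'

SNonEmpty : ∀ {n} → SimpleGraph n → Cut n → Set
SNonEmpty G c = (∃[ v ] inA c v ≡ true)
              ⊎ (∃[ i ] ∃[ j ] ∃[ k ] (isTri G i j k ≡ true × inB c i j k ≡ true))

trivialCut : ∀ {n} → Cut n
trivialCut = cut (λ _ → false) (λ _ _ _ → false)

DenseSet : ∀ {n} → SimpleGraph n → ℚ → Set
DenseSet {n} G α = ∃[ W ] (α * ℕ→ℚ (card {n} W) Data.Rational.< ℕ→ℚ (t₃ G W))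

-- Charge the arc s→v (capacity t_v) to the
-- t_v triangles containing v; then the capacity of a cut splits into a sum over
-- the triangles of G of a local cost depending only on which of the four nodes
-- (the three vertices and the triangle node) lie on the source side.  A finite
-- inspection of these local costs shows, with N the number of triangles and
-- X = S ∩ A:
--   * every cut satisfies           3N ≤ capℕ(S,T) + 3·t₃(X);
--   * the cut induced by a vertex set W (put W and the triangles inside W on
--     the source side) attains equality, and so does the trivial cut ({s}, …).
-- Since capacity = capℕ + 3α|X|, the trivial cut has capacity 3N, while every
-- cut has capacity ≥ 3N + 3(α|X| − t₃(X)).  Hence (b): with no dense set every
-- cut costs at least 3N; and (a): a dense W gives a cut of capacity < 3N, so a
-- minimum cut cannot have an empty source side.
module Submission where

open import Defs
open import Data.Nat using (ℕ)
open import Data.Rational using (ℚ; 0ℚ; _<_)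
open import Data.Product using (_×_)
open import Relation.Nullary using (¬_)

open import Data.Nat as ℕ using (zero; suc; _+_; _*_; _≤_; _<ᵇ_; z≤n; s≤s)
import Data.Nat.Properties as ℕ
open import Data.Bool using (Bool; true; false; _∧_; _∨_; not; if_then_else_)
import Data.Bool.Properties as Bool
open import Data.Fin using (Fin; zero; suc; _≟_; toℕ)
open import Data.Fin.Properties using (any?)
open import Data.Product using (_,_)
open import Data.Sum using (_⊎_; inj₁; inj₂)
import Data.Integer as ℤ
import Data.Integer.Properties as ℤ
open import Data.Rational as ℚ using (mkℚ; *≤*; Positive; NonNegative)
import Data.Rational.Properties as ℚ
import Data.Rational.Unnormalised as ℚᵘ
import Data.Rational.Unnormalised.Properties as ℚᵘ
open import Data.Nat.Coprimality using (1-coprimeTo)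
import Data.Nat.Coprimality as Coprimality
open import Algebra.Properties.Semiring.Sum ℕ.+-*-semiring
  using (sum; sum-cong-≗; ∑-distrib-+; ∑-comm; *-distribˡ-sum)
open import Function.Bundles using (Equivalence)
open import Relation.Nullary using (yes; no; contradiction)
open import Relation.Nullary.Decidable using (⌊_⌋; _×-dec_; _⊎-dec_)
open import Relation.Binary.PropositionalEquality
  using (_≡_; _≢_; refl; trans; cong; cong₂; subst₂; module ≡-Reasoning)
import Relation.Binary.PropositionalEquality as ≡

Σℕ≡sum : ∀ n (f : Fin n → ℕ) → Σℕ n f ≡ sum f
Σℕ≡sum zero    f = refl
Σℕ≡sum (suc n) f = cong (f zero +_) (Σℕ≡sum n (λ i → f (suc i)))

Σ-cong : ∀ n {f g : Fin n → ℕ} → (∀ i → f i ≡ g i) → Σℕ n f ≡ Σℕ n g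
Σ-cong zero    f≗g = refl
Σ-cong (suc n) f≗g = cong₂ _+_ (f≗g zero) (Σ-cong n (λ i → f≗g (suc i)))

Σ-mono : ∀ n {f g : Fin n → ℕ} → (∀ i → f i ≤ g i) → Σℕ n f ≤ Σℕ n g
Σ-mono zero    f≤g = z≤n
Σ-mono (suc n) f≤g = ℕ.+-mono-≤ (f≤g zero) (Σ-mono n (λ i → f≤g (suc i)))

Σ-zero : ∀ n → Σℕ n (λ _ → 0) ≡ 0
Σ-zero zero    = refl
Σ-zero (suc n) = Σ-zero n

Σ-distrib-+ : ∀ n (f g : Fin n → ℕ) → Σℕ n (λ i → f i + g i) ≡ Σℕ n f + Σℕ n g
Σ-distrib-+ n f g = begin
  Σℕ n (λ i → f i + g i)  ≡⟨ Σℕ≡sum n _ ⟩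
  sum (λ i → f i + g i)   ≡⟨ ∑-distrib-+ f g ⟩
  sum f + sum g           ≡⟨ ≡.sym (cong₂ _+_ (Σℕ≡sum n f) (Σℕ≡sum n g)) ⟩
  Σℕ n f + Σℕ n g         ∎
  where open ≡-Reasoning

Σ-distribˡ-* : ∀ n c (f : Fin n → ℕ) → Σℕ n (λ i → c * f i) ≡ c * Σℕ n f
Σ-distribˡ-* n c f = begin
  Σℕ n (λ i → c * f i)  ≡⟨ Σℕ≡sum n _ ⟩
  sum (λ i → c * f i)   ≡⟨ ≡.sym (*-distribˡ-sum c f) ⟩
  c * sum f             ≡⟨ cong (c *_) (≡.sym (Σℕ≡sum n f)) ⟩
  c * Σℕ n f            ∎
  where open ≡-Reasoning

Σ-comm : ∀ m n (f : Fin m → Fin n → ℕ) →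
         Σℕ m (λ i → Σℕ n (f i)) ≡ Σℕ n (λ j → Σℕ m (λ i → f i j))
Σ-comm m n f = begin
  Σℕ m (λ i → Σℕ n (f i))             ≡⟨ Σℕ≡sum m (λ i → Σℕ n (f i)) ⟩
  sum (λ i → Σℕ n (f i))              ≡⟨ sum-cong-≗ (λ i → Σℕ≡sum n (f i)) ⟩
  sum (λ i → sum (f i))               ≡⟨ ∑-comm f ⟩
  sum (λ j → sum (λ i → f i j))       ≡⟨ sum-cong-≗ (λ j → ≡.sym (Σℕ≡sum m (λ i → f i j))) ⟩
  sum (λ j → Σℕ m (λ i → f i j))      ≡⟨ ≡.sym (Σℕ≡sum n _) ⟩
  Σℕ n (λ j → Σℕ m (λ i → f i j))     ∎
  where open ≡-Reasoning

δ : ∀ {n} → Fin n → Fin n → ℕ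
δ i v = bit ⌊ v ≟ i ⌋

Σ-δ : ∀ n (i : Fin n) (f : Fin n → ℕ) → Σℕ n (λ v → δ i v * f v) ≡ f i
Σ-δ (suc n) zero    f = begin
  f zero + 0 + Σℕ n (λ _ → 0)  ≡⟨ cong (f zero + 0 +_) (Σ-zero n) ⟩
  f zero + 0 + 0               ≡⟨ ℕ.+-identityʳ _ ⟩
  f zero + 0                   ≡⟨ ℕ.+-identityʳ _ ⟩
  f zero                       ∎
  where open ≡-Reasoning
Σ-δ (suc n) (suc i) f =
  trans (Σ-cong n (λ v → cong (_* f (suc v)) (δ-suc i v))) (Σ-δ n i (λ v → f (suc v)))
  where
  δ-suc : ∀ {m} (i v : Fin m) → δ (suc i) (suc v) ≡ δ i v
  δ-suc i v with v ≟ i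
  ... | yes _ = refl
  ... | no _  = refl

module _ (n : ℕ) where

  Σ³-cong : {f g : Fin n → Fin n → Fin n → ℕ} →
            (∀ i j k → f i j k ≡ g i j k) → Σ³ n f ≡ Σ³ n g
  Σ³-cong f≗g = Σ-cong n (λ i → Σ-cong n (λ j → Σ-cong n (λ k → f≗g i j k)))

  Σ³-mono : {f g : Fin n → Fin n → Fin n → ℕ} →
            (∀ i j k → f i j k ≤ g i j k) → Σ³ n f ≤ Σ³ n g
  Σ³-mono f≤g = Σ-mono n (λ i → Σ-mono n (λ j → Σ-mono n (λ k → f≤g i j k)))

  Σ³-zero : Σ³ n (λ _ _ _ → 0) ≡ 0
  Σ³-zero = trans (Σ-cong n (λ _ → trans (Σ-cong n (λ _ → Σ-zero n)) (Σ-zero n))) (Σ-zero n)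

  Σ³-distrib-+ : (f g : Fin n → Fin n → Fin n → ℕ) →
                 Σ³ n (λ i j k → f i j k + g i j k) ≡ Σ³ n f + Σ³ n g
  Σ³-distrib-+ f g =
    trans (Σ-cong n (λ i → trans (Σ-cong n (λ j → Σ-distrib-+ n (f i j) (g i j)))
                                 (Σ-distrib-+ n _ _)))
          (Σ-distrib-+ n _ _)

  Σ³-distribˡ-* : ∀ c (f : Fin n → Fin n → Fin n → ℕ) →
                  Σ³ n (λ i j k → c * f i j k) ≡ c * Σ³ n f
  Σ³-distribˡ-* c f =
    trans (Σ-cong n (λ i → trans (Σ-cong n (λ j → Σ-distribˡ-* n c (f i j)))
                                 (Σ-distribˡ-* n c _)))
          (Σ-distribˡ-* n c _)

  Σ-Σ³-comm : (F : Fin n → Fin n → Fin n → Fin n → ℕ) →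
              Σℕ n (λ v → Σ³ n (F v)) ≡ Σ³ n (λ i j k → Σℕ n (λ v → F v i j k))
  Σ-Σ³-comm F =
    trans (Σ-comm n n (λ v i → Σℕ n λ j → Σℕ n λ k → F v i j k))
          (Σ-cong n (λ i → trans (Σ-comm n n (λ v j → Σℕ n λ k → F v i j k))
                                 (Σ-cong n (λ j → Σ-comm n n (λ v k → F v i j k)))))

δ-triple : ∀ {n} {i j k : Fin n} → i ≢ j × j ≢ k × i ≢ k → ∀ v →
           bit (⌊ v ≟ i ⌋ ∨ ⌊ v ≟ j ⌋ ∨ ⌊ v ≟ k ⌋) ≡ δ i v + δ j v + δ k v
δ-triple {i = i} {j} {k} (i≢j , j≢k , i≢k) v with v ≟ i | v ≟ j | v ≟ k
... | yes refl | yes refl | _        = contradiction refl i≢j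
... | yes refl | no _     | yes refl = contradiction refl i≢k
... | no _     | yes refl | yes refl = contradiction refl j≢k
... | yes _    | no _     | no _     = refl
... | no _     | yes _    | no _     = refl
... | no _     | no _     | yes _    = refl
... | no _     | no _     | no _     = refl

triangle-ordered : ∀ {n} (G : SimpleGraph n) {i j k} → isTri G i j k ≡ true →
                   toℕ i ℕ.< toℕ j × toℕ j ℕ.< toℕ k
triangle-ordered G {i} {j} {k} tri
  with toℕ i <ᵇ toℕ j in i<ᵇj | toℕ j <ᵇ toℕ k in j<ᵇk
... | true | true = <ᵇ⇒< i<ᵇj , <ᵇ⇒< j<ᵇk
  where
  <ᵇ⇒< : ∀ {a b} → (a <ᵇ b) ≡ true → a ℕ.< b
  <ᵇ⇒< {a} {b} eq = ℕ.<ᵇ⇒< a b (Equivalence.from Bool.T-≡ eq)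

triangle-distinct : ∀ {n} (G : SimpleGraph n) {i j k} → isTri G i j k ≡ true →
                    i ≢ j × j ≢ k × i ≢ k
triangle-distinct G tri with triangle-ordered G tri
... | i<j , j<k = (λ i≡j → ℕ.<-irrefl (cong toℕ i≡j) i<j)
                , (λ j≡k → ℕ.<-irrefl (cong toℕ j≡k) j<k)
                , (λ i≡k → ℕ.<-irrefl (cong toℕ i≡k) (ℕ.<-trans i<j j<k))

module _ {n : ℕ} (G : SimpleGraph n) where

  incidence : Fin n → Fin n → Fin n → Fin n → ℕ
  incidence v i j k = bit (isTri G i j k ∧ (⌊ v ≟ i ⌋ ∨ ⌊ v ≟ j ⌋ ∨ ⌊ v ≟ k ⌋))

  onTriangle : (Fin n → ℕ) → Fin n → Fin n → Fin n → ℕ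
  onTriangle g i j k = if isTri G i j k then g i + g j + g k else 0

  incidences : ∀ (g : Fin n → ℕ) i j k →
               Σℕ n (λ v → incidence v i j k * g v) ≡ onTriangle g i j k
  incidences g i j k with isTri G i j k in tri
  ... | false = Σ-zero n
  ... | true  = begin
    Σℕ n (λ v → bit (⌊ v ≟ i ⌋ ∨ ⌊ v ≟ j ⌋ ∨ ⌊ v ≟ k ⌋) * g v)
      ≡⟨ Σ-cong n (λ v → cong (_* g v) (δ-triple (triangle-distinct G tri) v)) ⟩
    Σℕ n (λ v → (δ i v + δ j v + δ k v) * g v)
      ≡⟨ Σ-cong n (λ v → distrib v) ⟩
    Σℕ n (λ v → δ i v * g v + δ j v * g v + δ k v * g v)
      ≡⟨ trans (Σ-distrib-+ n _ _) (cong (_+ _) (Σ-distrib-+ n _ _)) ⟩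
    Σℕ n (λ v → δ i v * g v) + Σℕ n (λ v → δ j v * g v) + Σℕ n (λ v → δ k v * g v)
      ≡⟨ cong₂ _+_ (cong₂ _+_ (Σ-δ n i g) (Σ-δ n j g)) (Σ-δ n k g) ⟩
    g i + g j + g k ∎
    where
    open ≡-Reasoning
    distrib : ∀ v → (δ i v + δ j v + δ k v) * g v ≡ δ i v * g v + δ j v * g v + δ k v * g v
    distrib v = trans (ℕ.*-distribʳ-+ (g v) (δ i v + δ j v) (δ k v))
                      (cong (_+ δ k v * g v) (ℕ.*-distribʳ-+ (g v) (δ i v) (δ j v)))

  double-counting : (g : Fin n → ℕ) →
                    Σℕ n (λ v → tv G v * g v) ≡ Σ³ n (onTriangle g)
  double-counting g = begin
    Σℕ n (λ v → tv G v * g v)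
      ≡⟨ Σ-cong n (λ v → trans (ℕ.*-comm (tv G v) (g v))
                               (≡.sym (Σ³-distribˡ-* n (g v) (incidence v)))) ⟩
    Σℕ n (λ v → Σ³ n (λ i j k → g v * incidence v i j k))
      ≡⟨ Σ-Σ³-comm n (λ v i j k → g v * incidence v i j k) ⟩
    Σ³ n (λ i j k → Σℕ n (λ v → g v * incidence v i j k))
      ≡⟨ Σ³-cong n (λ i j k → trans (Σ-cong n (λ v → ℕ.*-comm (g v) _))
                                    (incidences g i j k)) ⟩
    Σ³ n (onTriangle g) ∎
    where open ≡-Reasoning

-- Arcs of H_α charged to one triangle {i,j,k}, given which of i, j, k and the
-- triangle node lie in S: one unit of the arc s→v for each vertex v ∉ S (that
-- arc has capacity t_v, one unit per triangle at v), plus the six arcs between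
-- the triangle node and its vertices.
localCost : Bool → Bool → Bool → Bool → ℕ
localCost a b c t = bit (not a) + bit (not b) + bit (not c)
                    + (triArc a t + triArc b t + triArc c t)

localCost-bound : ∀ a b c t → 3 ≤ localCost a b c t + 3 * bit (a ∧ b ∧ c)
localCost-bound true  true  true  true  = s≤s (s≤s (s≤s z≤n))
localCost-bound true  true  true  false = s≤s (s≤s (s≤s z≤n))
localCost-bound true  true  false true  = s≤s (s≤s (s≤s z≤n))
localCost-bound true  true  false false = s≤s (s≤s (s≤s z≤n))
localCost-bound true  false true  true  = s≤s (s≤s (s≤s z≤n))
localCost-bound true  false true  false = s≤s (s≤s (s≤s z≤n))
localCost-bound true  false false true  = s≤s (s≤s (s≤s z≤n))
localCost-bound true  false false false = s≤s (s≤s (s≤s z≤n))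
localCost-bound false true  true  true  = s≤s (s≤s (s≤s z≤n))
localCost-bound false true  true  false = s≤s (s≤s (s≤s z≤n))
localCost-bound false true  false true  = s≤s (s≤s (s≤s z≤n))
localCost-bound false true  false false = s≤s (s≤s (s≤s z≤n))
localCost-bound false false true  true  = s≤s (s≤s (s≤s z≤n))
localCost-bound false false true  false = s≤s (s≤s (s≤s z≤n))
localCost-bound false false false true  = s≤s (s≤s (s≤s z≤n))
localCost-bound false false false false = s≤s (s≤s (s≤s z≤n))

localCost-tight : ∀ a b c → localCost a b c (a ∧ b ∧ c) + 3 * bit (a ∧ b ∧ c) ≡ 3
localCost-tight true  true  true  = refl
localCost-tight true  true  false = refl
localCost-tight true  false true  = refl
localCost-tight true  false false = refl
localCost-tight false true  true  = refl
localCost-tight false true  false = refl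
localCost-tight false false true  = refl
localCost-tight false false false = refl

module _ {n : ℕ} (G : SimpleGraph n) where

  #triangles : ℕ
  #triangles = Σ³ n (λ i j k → bit (isTri G i j k))

  chargedCost : Cut n → Fin n → Fin n → Fin n → ℕ
  chargedCost c i j k =
    if isTri G i j k
    then localCost (inA c i) (inA c j) (inA c k) (inB c i j k)
         + 3 * bit (inA c i ∧ inA c j ∧ inA c k)
    else 0

  capacity-by-triangles : ∀ c → capℕ G c + 3 * t₃ G (inA c) ≡ Σ³ n (chargedCost c)
  capacity-by-triangles c = begin
    capℕ G c + 3 * t₃ G (inA c)
      ≡⟨ cong₂ _+_ (cong (_+ Σ³ n arcs) sourceArcs) (≡.sym (Σ³-distribˡ-* n 3 inside)) ⟩
    Σ³ n (onTriangle G outside) + Σ³ n arcs + Σ³ n (λ i j k → 3 * inside i j k)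
      ≡⟨ ≡.sym (trans (Σ³-distrib-+ n _ (λ i j k → 3 * inside i j k))
                     (cong (_+ Σ³ n (λ i j k → 3 * inside i j k)) (Σ³-distrib-+ n _ arcs))) ⟩
    Σ³ n (λ i j k → onTriangle G outside i j k + arcs i j k + 3 * inside i j k)
      ≡⟨ Σ³-cong n pointwise ⟩
    Σ³ n (chargedCost c) ∎
    where
    open ≡-Reasoning
    X : Subset n
    X = inA c
    outside : Fin n → ℕ
    outside v = bit (not (X v))
    inside : Fin n → Fin n → Fin n → ℕ
    inside i j k = bit (isTri G i j k ∧ X i ∧ X j ∧ X k)
    arcs : Fin n → Fin n → Fin n → ℕ
    arcs i j k = if isTri G i j k
                 then triArc (X i) (inB c i j k) + triArc (X j) (inB c i j k)
                      + triArc (X k) (inB c i j k)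
                 else 0
    sourceArc : ∀ v → (if X v then 0 else tv G v) ≡ tv G v * outside v
    sourceArc v with X v
    ... | true  = ≡.sym (ℕ.*-zeroʳ (tv G v))
    ... | false = ≡.sym (ℕ.*-identityʳ (tv G v))
    sourceArcs : Σℕ n (λ v → if X v then 0 else tv G v) ≡ Σ³ n (onTriangle G outside)
    sourceArcs = trans (Σ-cong n sourceArc) (double-counting G outside)
    pointwise : ∀ i j k → onTriangle G outside i j k + arcs i j k + 3 * inside i j k
                          ≡ chargedCost c i j k
    pointwise i j k with isTri G i j k
    ... | true  = refl
    ... | false = refl

  capacity-lower-bound : ∀ c → 3 * #triangles ≤ capℕ G c + 3 * t₃ G (inA c)
  capacity-lower-bound c = begin
    3 * #triangles                       ≡⟨ ≡.sym (Σ³-distribˡ-* n 3 _) ⟩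
    Σ³ n (λ i j k → 3 * bit (isTri G i j k)) ≤⟨ Σ³-mono n pointwise ⟩
    Σ³ n (chargedCost c)                 ≡⟨ ≡.sym (capacity-by-triangles c) ⟩
    capℕ G c + 3 * t₃ G (inA c)          ∎
    where
    open ℕ.≤-Reasoning
    pointwise : ∀ i j k → 3 * bit (isTri G i j k) ≤ chargedCost c i j k
    pointwise i j k with isTri G i j k
    ... | true  = localCost-bound (inA c i) (inA c j) (inA c k) (inB c i j k)
    ... | false = z≤n

  Consistent : Cut n → Set
  Consistent c = ∀ i j k → isTri G i j k ≡ true →
                 inB c i j k ≡ (inA c i ∧ inA c j ∧ inA c k)

  consistent-capacity : ∀ c → Consistent c →
                        capℕ G c + 3 * t₃ G (inA c) ≡ 3 * #triangles
  consistent-capacity c consistent = begin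
    capℕ G c + 3 * t₃ G (inA c)               ≡⟨ capacity-by-triangles c ⟩
    Σ³ n (chargedCost c)                      ≡⟨ Σ³-cong n pointwise ⟩
    Σ³ n (λ i j k → 3 * bit (isTri G i j k))  ≡⟨ Σ³-distribˡ-* n 3 _ ⟩
    3 * #triangles                            ∎
    where
    open ≡-Reasoning
    pointwise : ∀ i j k → chargedCost c i j k ≡ 3 * bit (isTri G i j k)
    pointwise i j k with isTri G i j k in tri
    ... | true rewrite consistent i j k tri = localCost-tight (inA c i) (inA c j) (inA c k)
    ... | false = refl

  inducedCut : Subset n → Cut n
  inducedCut W = cut W (λ i j k → W i ∧ W j ∧ W k)

  EmptySource : Cut n → Set
  EmptySource c = (∀ v → inA c v ≡ false)
                × (∀ i j k → isTri G i j k ≡ true → inB c i j k ≡ false)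

  emptySource-capℕ : ∀ c → EmptySource c → capℕ G c ≡ 3 * #triangles
  emptySource-capℕ c (noVertex , noTriangle) = begin
    capℕ G c                      ≡⟨ ≡.sym (ℕ.+-identityʳ (capℕ G c)) ⟩
    capℕ G c + 3 * 0              ≡⟨ cong (λ m → capℕ G c + 3 * m) (≡.sym noTriangleInside) ⟩
    capℕ G c + 3 * t₃ G (inA c)   ≡⟨ consistent-capacity c consistent ⟩
    3 * #triangles                ∎
    where
    open ≡-Reasoning
    consistent : Consistent c
    consistent i j k tri rewrite noVertex i = noTriangle i j k tri
    nothingInside : ∀ i j k → bit (isTri G i j k ∧ inA c i ∧ inA c j ∧ inA c k) ≡ 0
    nothingInside i j k rewrite noVertex i = cong bit (Bool.∧-zeroʳ (isTri G i j k))
    noTriangleInside : t₃ G (inA c) ≡ 0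
    noTriangleInside = trans (Σ³-cong n nothingInside) (Σ³-zero n)

  emptySource-card : ∀ c → EmptySource c → card (inA c) ≡ 0
  emptySource-card c (noVertex , _) = trans (Σ-cong n (λ v → cong bit (noVertex v))) (Σ-zero n)

  sourceSide? : ∀ c → SNonEmpty G c ⊎ EmptySource c
  sourceSide? c with any? (λ v → inA c v Bool.≟ true)
                   ⊎-dec any? (λ i → any? (λ j → any? (λ k →
                           (isTri G i j k Bool.≟ true) ×-dec (inB c i j k Bool.≟ true))))
  ... | yes nonEmpty = inj₁ nonEmpty
  ... | no empty =
    inj₂ ( (λ v → Bool.¬-not (λ inS → empty (inj₁ (v , inS))))
         , (λ i j k tri → Bool.¬-not (λ inS → empty (inj₂ (i , j , k , tri , inS)))) )

ℕ→ℚ-normal : ℕ → ℚ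
ℕ→ℚ-normal m = mkℚ (ℤ.+ m) 0 (Coprimality.sym (1-coprimeTo m))

ℕ→ℚ≡mkℚ : ∀ m → ℕ→ℚ m ≡ ℕ→ℚ-normal m
ℕ→ℚ≡mkℚ m = ℚ.normalize-coprime (Coprimality.sym (1-coprimeTo m))

ℕ→ℚ-+ : ∀ m n → ℕ→ℚ (m + n) ≡ ℕ→ℚ m ℚ.+ ℕ→ℚ n
ℕ→ℚ-+ m n rewrite ℕ→ℚ≡mkℚ m | ℕ→ℚ≡mkℚ n | ℕ→ℚ≡mkℚ (m + n) =
  ℚ.toℚᵘ-injective (ℚᵘ.≃-trans (ℚᵘ.*≡* numerators)
                               (ℚᵘ.≃-sym (ℚ.toℚᵘ-homo-+ (ℕ→ℚ-normal m) (ℕ→ℚ-normal n))))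
  where
  numerators : ℤ.+ (m + n) ℤ.* ℤ.+ 1 ≡ (ℤ.+ m ℤ.* ℤ.+ 1 ℤ.+ ℤ.+ n ℤ.* ℤ.+ 1) ℤ.* ℤ.+ 1
  numerators rewrite ℤ.*-identityʳ (ℤ.+ m) | ℤ.*-identityʳ (ℤ.+ n) = refl

ℕ→ℚ-* : ∀ m n → ℕ→ℚ (m * n) ≡ ℕ→ℚ m ℚ.* ℕ→ℚ n
ℕ→ℚ-* m n rewrite ℕ→ℚ≡mkℚ m | ℕ→ℚ≡mkℚ n | ℕ→ℚ≡mkℚ (m * n) =
  ℚ.toℚᵘ-injective (ℚᵘ.≃-trans (ℚᵘ.*≡* (cong (ℤ._* ℤ.+ 1) (ℤ.pos-* m n)))
                               (ℚᵘ.≃-sym (ℚ.toℚᵘ-homo-* (ℕ→ℚ-normal m) (ℕ→ℚ-normal n))))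

ℕ→ℚ-mono-≤ : ∀ {m n} → m ≤ n → ℕ→ℚ m ℚ.≤ ℕ→ℚ n
ℕ→ℚ-mono-≤ {m} {n} m≤n rewrite ℕ→ℚ≡mkℚ m | ℕ→ℚ≡mkℚ n =
  *≤* (subst₂ ℤ._≤_ (≡.sym (ℤ.*-identityʳ (ℤ.+ m))) (≡.sym (ℤ.*-identityʳ (ℤ.+ n)))
                    (ℤ.+≤+ m≤n))

3-positive : Positive (ℕ→ℚ 3)
3-positive = _

3-nonNegative : NonNegative (ℕ→ℚ 3)
3-nonNegative = ℚ.pos⇒nonNeg (ℕ→ℚ 3) {{3-positive}}

module _ {n : ℕ} (G : SimpleGraph n) (α : ℚ) where

  capacity-split : ∀ c → capacity G α c
                   ≡ ℕ→ℚ (capℕ G c) ℚ.+ ℕ→ℚ 3 ℚ.* (α ℚ.* ℕ→ℚ (card (inA c)))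
  capacity-split c = cong (ℕ→ℚ (capℕ G c) ℚ.+_) (ℚ.*-assoc (ℕ→ℚ 3) α _)

  ℕ→ℚ-+3* : ∀ C t → ℕ→ℚ (C + 3 * t) ≡ ℕ→ℚ C ℚ.+ ℕ→ℚ 3 ℚ.* ℕ→ℚ t
  ℕ→ℚ-+3* C t = trans (ℕ→ℚ-+ C (3 * t)) (cong (ℕ→ℚ C ℚ.+_) (ℕ→ℚ-* 3 t))

  sparse-capacity-bound : ∀ c → ℕ→ℚ (t₃ G (inA c)) ℚ.≤ α ℚ.* ℕ→ℚ (card (inA c)) →
                          ℕ→ℚ (3 * #triangles G) ℚ.≤ capacity G α c
  sparse-capacity-bound c sparse = begin
    ℕ→ℚ (3 * #triangles G)                     ≤⟨ ℕ→ℚ-mono-≤ (capacity-lower-bound G c) ⟩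
    ℕ→ℚ (C + 3 * t₃ G X)                       ≡⟨ ℕ→ℚ-+3* C (t₃ G X) ⟩
    ℕ→ℚ C ℚ.+ ℕ→ℚ 3 ℚ.* ℕ→ℚ (t₃ G X)           ≤⟨ ℚ.+-monoʳ-≤ (ℕ→ℚ C)
                                                     (ℚ.*-monoˡ-≤-nonNeg (ℕ→ℚ 3) {{3-nonNegative}} sparse) ⟩
    ℕ→ℚ C ℚ.+ ℕ→ℚ 3 ℚ.* (α ℚ.* ℕ→ℚ (card X))   ≡⟨ ≡.sym (capacity-split c) ⟩
    capacity G α c                             ∎
    where
    open ℚ.≤-Reasoning
    X : Subset n
    X = inA c
    C : ℕ
    C = capℕ G c

  dense-capacity-bound : ∀ W → α ℚ.* ℕ→ℚ (card W) < ℕ→ℚ (t₃ G W) →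
                         capacity G α (inducedCut G W) < ℕ→ℚ (3 * #triangles G)
  dense-capacity-bound W dense = begin-strict
    capacity G α (inducedCut G W)              ≡⟨ capacity-split (inducedCut G W) ⟩
    ℕ→ℚ C ℚ.+ ℕ→ℚ 3 ℚ.* (α ℚ.* ℕ→ℚ (card W))   <⟨ ℚ.+-monoʳ-< (ℕ→ℚ C)
                                                     (ℚ.*-monoʳ-<-pos (ℕ→ℚ 3) {{3-positive}} dense) ⟩
    ℕ→ℚ C ℚ.+ ℕ→ℚ 3 ℚ.* ℕ→ℚ (t₃ G W)           ≡⟨ ≡.sym (ℕ→ℚ-+3* C (t₃ G W)) ⟩
    ℕ→ℚ (C + 3 * t₃ G W)                       ≡⟨ cong ℕ→ℚ (consistent-capacity G (inducedCut G W)
                                                                                (λ _ _ _ _ → refl)) ⟩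
    ℕ→ℚ (3 * #triangles G)                     ∎
    where
    open ℚ.≤-Reasoning
    C : ℕ
    C = capℕ G (inducedCut G W)

  emptySource-capacity : ∀ c → EmptySource G c → capacity G α c ≡ ℕ→ℚ (3 * #triangles G)
  emptySource-capacity c empty = begin
    capacity G α c
      ≡⟨ cong₂ (λ C m → ℕ→ℚ C ℚ.+ ℕ→ℚ 3 ℚ.* α ℚ.* ℕ→ℚ m)
               (emptySource-capℕ G c empty) (emptySource-card G c empty) ⟩
    ℕ→ℚ (3 * #triangles G) ℚ.+ ℕ→ℚ 3 ℚ.* α ℚ.* 0ℚ
      ≡⟨ cong (ℕ→ℚ (3 * #triangles G) ℚ.+_) (ℚ.*-zeroʳ (ℕ→ℚ 3 ℚ.* α)) ⟩
    ℕ→ℚ (3 * #triangles G) ℚ.+ 0ℚ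
      ≡⟨ ℚ.+-identityʳ _ ⟩
    ℕ→ℚ (3 * #triangles G) ∎
    where open ≡-Reasoning

lemma3 : (n : ℕ) (G : SimpleGraph n) (α : ℚ) → 0ℚ < α →
    (DenseSet G α → (c : Cut n) → IsMinCut G α c → SNonEmpty G c)
    × (¬ DenseSet G α → IsMinCut G α trivialCut)
lemma3 n G α _ = minCut-nonEmpty , trivialCut-minimal
  where
  open ℚ.≤-Reasoning

  minCut-nonEmpty : DenseSet G α → (c : Cut n) → IsMinCut G α c → SNonEmpty G c
  minCut-nonEmpty (W , dense) c minimal with sourceSide? G c
  ... | inj₁ nonEmpty = nonEmpty
  ... | inj₂ empty    = contradiction cW<cW (ℚ.<-irrefl refl)
    where
    cW<cW : capacity G α (inducedCut G W) < capacity G α (inducedCut G W)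
    cW<cW = begin-strict
      capacity G α (inducedCut G W)  <⟨ dense-capacity-bound G α W dense ⟩
      ℕ→ℚ (3 * #triangles G)         ≡⟨ ≡.sym (emptySource-capacity G α c empty) ⟩
      capacity G α c                 ≤⟨ minimal (inducedCut G W) ⟩
      capacity G α (inducedCut G W)  ∎

  trivialCut-minimal : ¬ DenseSet G α → IsMinCut G α trivialCut
  trivialCut-minimal sparse c = begin
    capacity G α trivialCut  ≡⟨ emptySource-capacity G α trivialCut trivialCut-empty ⟩
    ℕ→ℚ (3 * #triangles G)   ≤⟨ sparse-capacity-bound G α c
                                   (ℚ.≮⇒≥ (λ dense → sparse (inA c , dense))) ⟩
    capacity G α c           ∎
    where
    trivialCut-empty : EmptySource G trivialCut
    trivialCut-empty = (λ _ → refl) , (λ _ _ _ _ → refl)
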